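{- Let $M = (M_{i,j})_{i,j \ge 0}$ be the infinite matrix indexed by natural numbers with $M_{i,j} = 2$ if $j - i = 1$, $M_{i,j} = 1$ if $j - i = 2^q$ for some integer $q \ge 1$, and $M_{i,j} = 0$ otherwise. For $n \ge 1$, the sum of the entries of the $n\times n$ upper-left submatrix $(M_{i,j})_{0 \le i,j < n}$ equals $s(n) = n(\lfloor \log_2 n \rfloor + 2) - 2^{\lfloor \log_2 n \rfloor + 1}$. -}

module Defs where

open import Data.Nat using (ℕ; zero; suc; _+_; _*_; _∸_; _^_; _≤_; _<_; _<ᵇ_; _≡ᵇ_)
open import Data.Nat.Logarithm using (⌊log₂_⌋)
open import Data.Bool using (Bool; true; false; if_then_else_; _∧_)
open import Data.List using (List; map; upTo)
open import Data.Nat.ListAction using (sum)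
open import Data.Bool.ListAction using (any)

-- isPow2Pos d = true  iff  d = 2^q for some integer q ≥ 1.
-- Search over q ∈ {1, …, d} suffices since 2^q > q for all q.
isPow2Pos : ℕ → Bool
isPow2Pos d = any (λ q → (2 ^ suc q) ≡ᵇ d) (upTo d)

M : ℕ → ℕ → ℕ
M i j = if i <ᵇ j
          then (if (j ∸ i) ≡ᵇ 1 then 2 else (if isPow2Pos (j ∸ i) then 1 else 0))
          else 0

submatrixSum : ℕ → ℕ
submatrixSum n = sum (map (λ i → sum (map (λ j → M i j) (upTo n))) (upTo n))

-- s(n) = n (⌊log₂ n⌋ + 2) - 2^(⌊log₂ n⌋ + 1)   (nonnegative for n ≥ 1)
s : ℕ → ℕ
s n = n * (⌊log₂ n ⌋ + 2) ∸ 2 ^ (⌊log₂ n ⌋ + 1)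

module Submission where

-- M i j depends only on j ∸ i, so column j ≥ 1 sums to M 0 1 + … + M 0 j: the entry 2 at
-- distance 1 plus one for each power 2^q ≤ j with q ≥ 1, that is ⌊log₂ j⌋ + 2.  Adding the
-- columns one at a time, the identity submatrixSum n + 2^(k+1) = n (k + 2) persists through the
-- dyadic block 2^k ≤ n < 2^(k+1), and also across the step into the next block, because there
-- the increase 2^(k+1) of the power of two is exactly n.

open import Defs
open import Data.Nat using (ℕ; zero; suc; _+_; _*_; _∸_; _^_; _≤_; _<_; _<ᵇ_; _≡ᵇ_; z≤n; s≤s; z<s; s<s; ⌊_/2⌋)
open import Data.Nat.Properties
open import Data.Nat.Logarithm using (⌊log₂_⌋; ⌊log₂⌋-mono-≤; ⌊log₂[2^n]⌋≡n; ⌊log₂⌊n/2⌋⌋≡⌊log₂n⌋∸1)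
open import Algebra.Properties.CommutativeSemigroup +-commutativeSemigroup using (interchange; xy∙z≈xz∙y)
open import Data.Bool using (true; false; T; if_then_else_)
open import Data.Bool.Properties using (T-≡)
open import Function.Bundles using (Equivalence)
open import Data.List using ([]; _∷_; _++_; map; upTo)
open import Data.List.Properties using (upTo-∷ʳ; map-++; map-applyUpTo)
open import Data.List.Relation.Unary.Any.Properties using (any⁺; any⁻; applyUpTo⁺; applyUpTo⁻)
open import Data.Nat.ListAction using (sum)
open import Data.Nat.ListAction.Properties using (sum-++)
open import Data.Product using (∃; _,_)
open import Data.Sum using (inj₁; inj₂)
open import Data.Empty using (⊥-elim)
open import Function using (_∘_; id)
open import Data.Nat.Tactic.RingSolver using (solve-∀)
open import Relation.Binary.PropositionalEquality
  using (_≡_; refl; sym; trans; cong; cong₂; subst; module ≡-Reasoning)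
open ≡-Reasoning

sumBelow : ℕ → (ℕ → ℕ) → ℕ
sumBelow n f = sum (map f (upTo n))

sumBelow-suc : ∀ n f → sumBelow (suc n) f ≡ sumBelow n f + f n
sumBelow-suc n f = begin
  sum (map f (upTo (suc n)))         ≡⟨ cong (sum ∘ map f) (upTo-∷ʳ n) ⟨
  sum (map f (upTo n ++ n ∷ []))     ≡⟨ cong sum (map-++ f (upTo n) (n ∷ [])) ⟩
  sum (map f (upTo n) ++ f n ∷ [])   ≡⟨ sum-++ (map f (upTo n)) (f n ∷ []) ⟩
  sumBelow n f + (f n + 0)           ≡⟨ cong (sumBelow n f +_) (+-identityʳ (f n)) ⟩
  sumBelow n f + f n                 ∎

sumBelow-sucˡ : ∀ n f → sumBelow (suc n) f ≡ f 0 + sumBelow n (f ∘ suc)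
sumBelow-sucˡ n f = cong (λ xs → f 0 + sum xs)
  (trans (map-applyUpTo suc f n) (sym (map-applyUpTo id (f ∘ suc) n)))

sumBelow-cong : ∀ n {f g} → (∀ i → f i ≡ g i) → sumBelow n f ≡ sumBelow n g
sumBelow-cong zero    f≗g = refl
sumBelow-cong (suc n) {f} {g} f≗g = begin
  sumBelow (suc n) f   ≡⟨ sumBelow-suc n f ⟩
  sumBelow n f + f n   ≡⟨ cong₂ _+_ (sumBelow-cong n f≗g) (f≗g n) ⟩
  sumBelow n g + g n   ≡⟨ sumBelow-suc n g ⟨
  sumBelow (suc n) g   ∎

sumBelow-+ : ∀ n f g → sumBelow n (λ i → f i + g i) ≡ sumBelow n f + sumBelow n g
sumBelow-+ zero    f g = refl
sumBelow-+ (suc n) f g = begin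
  sumBelow (suc n) (λ i → f i + g i)                 ≡⟨ sumBelow-suc n _ ⟩
  sumBelow n (λ i → f i + g i) + (f n + g n)         ≡⟨ cong (_+ (f n + g n)) (sumBelow-+ n f g) ⟩
  (sumBelow n f + sumBelow n g) + (f n + g n)        ≡⟨ interchange (sumBelow n f) (sumBelow n g) (f n) (g n) ⟩
  (sumBelow n f + f n) + (sumBelow n g + g n)        ≡⟨ cong₂ _+_ (sumBelow-suc n f) (sumBelow-suc n g) ⟨
  sumBelow (suc n) f + sumBelow (suc n) g            ∎

n≤m⇒m<ᵇn≡false : ∀ {m n} → n ≤ m → (m <ᵇ n) ≡ false
n≤m⇒m<ᵇn≡false z≤n = refl
n≤m⇒m<ᵇn≡false {suc m} (s≤s n≤m) = n≤m⇒m<ᵇn≡false n≤m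

M-lower : ∀ {i j} → j ≤ i → M i j ≡ 0
M-lower j≤i rewrite n≤m⇒m<ᵇn≡false j≤i = refl

sumBelow-M-lower : ∀ n {i} → n ≤ i → sumBelow n (M i) ≡ 0
sumBelow-M-lower zero    n≤i = refl
sumBelow-M-lower (suc n) n<i = begin
  sumBelow (suc n) (M _)   ≡⟨ sumBelow-suc n (M _) ⟩
  sumBelow n (M _) + M _ n ≡⟨ cong₂ _+_ (sumBelow-M-lower n (<⇒≤ n<i)) (M-lower (<⇒≤ n<i)) ⟩
  0                        ∎

columnSum : ℕ → ℕ
columnSum j = sumBelow j (λ i → M i j)

-- M (suc i) (suc j) reduces to M i j, so dropping row 0 shifts the column.
columnSum-suc : ∀ n → columnSum (suc n) ≡ M 0 (suc n) + columnSum n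
columnSum-suc n = sumBelow-sucˡ n (λ i → M i (suc n))

submatrixSum-suc : ∀ n → submatrixSum (suc n) ≡ submatrixSum n + columnSum n
submatrixSum-suc n = begin
  sumBelow (suc n) (λ i → sumBelow (suc n) (M i))
    ≡⟨ sumBelow-cong (suc n) (λ i → sumBelow-suc n (M i)) ⟩
  sumBelow (suc n) (λ i → sumBelow n (M i) + M i n)
    ≡⟨ sumBelow-+ (suc n) (λ i → sumBelow n (M i)) (λ i → M i n) ⟩
  sumBelow (suc n) (λ i → sumBelow n (M i)) + sumBelow (suc n) (λ i → M i n)
    ≡⟨ cong₂ _+_ (sumBelow-suc n _) (sumBelow-suc n _) ⟩
  (submatrixSum n + sumBelow n (M n)) + (columnSum n + M n n)
    ≡⟨ cong₂ (λ a b → (submatrixSum n + a) + (columnSum n + b)) (sumBelow-M-lower n ≤-refl) (M-lower {n} ≤-refl) ⟩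
  (submatrixSum n + 0) + (columnSum n + 0)
    ≡⟨ cong₂ _+_ (+-identityʳ (submatrixSum n)) (+-identityʳ (columnSum n)) ⟩
  submatrixSum n + columnSum n
    ∎

record InBlock (k n : ℕ) : Set where
  constructor inBlock
  field
    lower : 2 ^ k ≤ n
    upper : n < 2 ^ suc k

2^n<2^[1+n] : ∀ n → 2 ^ n < 2 ^ suc n
2^n<2^[1+n] n = ^-monoʳ-< 2 (s<s z<s) (n<1+n n)

n<2^n : ∀ n → n < 2 ^ n
n<2^n zero    = z<s
n<2^n (suc n) = ≤-<-trans (n<2^n n) (2^n<2^[1+n] n)

m<2*n⇒⌊m/2⌋<n : ∀ {m} n → m < 2 * n → ⌊ m /2⌋ < n
m<2*n⇒⌊m/2⌋<n {zero}        (suc n) _ = z<s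
m<2*n⇒⌊m/2⌋<n {suc zero}    (suc n) _ = z<s
m<2*n⇒⌊m/2⌋<n {suc (suc m)} (suc n) (s≤s m<2n) =
  s<s (m<2*n⇒⌊m/2⌋<n n (≤-pred (subst (suc (suc m) ≤_) (+-suc n (n + 0)) m<2n)))

n<2^[1+k]⇒⌊log₂n⌋≤k : ∀ k {n} → n < 2 ^ suc k → ⌊log₂ n ⌋ ≤ k
n<2^[1+k]⇒⌊log₂n⌋≤k zero    {0} n<2 = z≤n
n<2^[1+k]⇒⌊log₂n⌋≤k zero    {1} n<2 = z≤n
n<2^[1+k]⇒⌊log₂n⌋≤k zero    {suc (suc n)} (s<s (s<s ()))
n<2^[1+k]⇒⌊log₂n⌋≤k (suc k) {n} n<2^[2+k] = m∸1≤n⇒m≤1+n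
  (subst (_≤ k) (⌊log₂⌊n/2⌋⌋≡⌊log₂n⌋∸1 n)
    (n<2^[1+k]⇒⌊log₂n⌋≤k k (m<2*n⇒⌊m/2⌋<n (2 ^ suc k) n<2^[2+k])))
  where
  m∸1≤n⇒m≤1+n : ∀ {m n} → m ∸ 1 ≤ n → m ≤ suc n
  m∸1≤n⇒m≤1+n {zero}  _ = z≤n
  m∸1≤n⇒m≤1+n {suc m} m≤n = s≤s m≤n

⌊log₂⌋-InBlock : ∀ {k n} → InBlock k n → ⌊log₂ n ⌋ ≡ k
⌊log₂⌋-InBlock {k} {n} (inBlock 2^k≤n n<2^[1+k]) = ≤-antisym
  (n<2^[1+k]⇒⌊log₂n⌋≤k k n<2^[1+k])
  (subst (_≤ ⌊log₂ n ⌋) (⌊log₂[2^n]⌋≡n k) (⌊log₂⌋-mono-≤ 2^k≤n))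

isPow2Pos-2^ : ∀ k → isPow2Pos (2 ^ suc k) ≡ true
isPow2Pos-2^ k = Equivalence.to T-≡
  (any⁺ _ (applyUpTo⁺ id {i = k} 2^[1+k]≡ᵇ2^[1+k] (<-trans (n<1+n k) (n<2^n (suc k)))))
  where
  2^[1+k]≡ᵇ2^[1+k] : T (2 ^ suc k ≡ᵇ 2 ^ suc k)
  2^[1+k]≡ᵇ2^[1+k] = ≡⇒≡ᵇ (2 ^ suc k) (2 ^ suc k) refl

isPow2Pos⇒2^ : ∀ {d} → isPow2Pos d ≡ true → ∃ λ q → 2 ^ suc q ≡ d
isPow2Pos⇒2^ {d} isPow with applyUpTo⁻ id (any⁻ _ (upTo d) (Equivalence.from T-≡ isPow))
... | q , _ , 2^[1+q]≡ᵇd = q , ≡ᵇ⇒≡ (2 ^ suc q) d 2^[1+q]≡ᵇd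

-- ⌊log₂⌋ recovers the exponent of a power of two, which pins it down to 2 ^ k.
isPow2Pos-interior : ∀ {k d} → InBlock k d → 2 ^ k < d → isPow2Pos d ≡ false
isPow2Pos-interior {k} {d} b 2^k<d with isPow2Pos d in isPow
... | false = refl
... | true with isPow2Pos⇒2^ isPow
...   | q , 2^[1+q]≡d = ⊥-elim (<-irrefl 2^k≡d 2^k<d)
  where
  2^k≡d : 2 ^ k ≡ d
  2^k≡d = begin
    2 ^ k                   ≡⟨ cong (2 ^_) (⌊log₂⌋-InBlock b) ⟨
    2 ^ ⌊log₂ d ⌋           ≡⟨ cong (λ n → 2 ^ ⌊log₂ n ⌋) 2^[1+q]≡d ⟨
    2 ^ ⌊log₂ 2 ^ suc q ⌋   ≡⟨ cong (2 ^_) (⌊log₂[2^n]⌋≡n (suc q)) ⟩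
    2 ^ suc q               ≡⟨ 2^[1+q]≡d ⟩
    d                       ∎

data Predecessor : ℕ → ℕ → Set where
  interior : ∀ {k m} → 2 ^ k < suc (suc m) → InBlock k (suc m) → Predecessor k m
  boundary : ∀ {k m} → suc (suc m) ≡ 2 ^ suc k → InBlock k (suc m) → Predecessor (suc k) m

predecessor : ∀ {k m} → InBlock k (suc (suc m)) → Predecessor k m
predecessor (inBlock 2^k≤n n<2^[1+k]) with m≤n⇒m<n∨m≡n 2^k≤n
... | inj₁ 2^k<n = interior 2^k<n (inBlock (≤-pred 2^k<n) (<-trans (n<1+n _) n<2^[1+k]))
predecessor {suc k} (inBlock _ _) | inj₂ 2^[1+k]≡n =
  boundary (sym 2^[1+k]≡n)
    (inBlock (≤-pred (subst (2 ^ k <_) 2^[1+k]≡n (2^n<2^[1+n] k))) (≤-reflexive (sym 2^[1+k]≡n)))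

blockOf : ∀ n → ∃ λ k → InBlock k (suc n)
blockOf zero = 0 , inBlock ≤-refl (s<s z<s)
blockOf (suc n) with blockOf n
... | k , inBlock 2^k≤n n<2^[1+k] with m≤n⇒m<n∨m≡n n<2^[1+k]
...   | inj₁ 1+n<2^[1+k] = k , inBlock (m≤n⇒m≤1+n 2^k≤n) 1+n<2^[1+k]
...   | inj₂ 1+n≡2^[1+k] = suc k ,
  inBlock (≤-reflexive (sym 1+n≡2^[1+k]))
          (subst (_< 2 ^ suc (suc k)) (sym 1+n≡2^[1+k]) (2^n<2^[1+n] (suc k)))

columnSum-InBlock : ∀ {k n} → InBlock k (suc n) → columnSum (suc n) ≡ k + 2
columnSum-InBlock {n = zero} b with ⌊log₂⌋-InBlock b
... | refl = refl
columnSum-InBlock {k} {suc m} b with predecessor b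
... | interior 2^k<n b′ = begin
  columnSum (suc (suc m))                                   ≡⟨ columnSum-suc (suc m) ⟩
  (if isPow2Pos (suc (suc m)) then 1 else 0) + columnSum (suc m)
    ≡⟨ cong₂ _+_ (cong (if_then 1 else 0) (isPow2Pos-interior b 2^k<n)) (columnSum-InBlock b′) ⟩
  k + 2                                                     ∎
... | boundary {k′} n≡2^[1+k′] b′ = trans (columnSum-suc (suc m)) (cong₂ _+_
  (cong (if_then 1 else 0) (trans (cong isPow2Pos n≡2^[1+k′]) (isPow2Pos-2^ k′)))
  (columnSum-InBlock b′))

submatrixSum-InBlock : ∀ {k n} → InBlock k (suc n) → submatrixSum (suc n) + 2 ^ suc k ≡ suc n * (k + 2)
submatrixSum-InBlock {n = zero} b with ⌊log₂⌋-InBlock b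
... | refl = refl
submatrixSum-InBlock {k} {suc m} b with predecessor b
... | interior _ b′ = begin
  submatrixSum (suc (suc m)) + 2 ^ suc k              ≡⟨ cong (_+ 2 ^ suc k) (submatrixSum-suc (suc m)) ⟩
  submatrixSum (suc m) + columnSum (suc m) + 2 ^ suc k
    ≡⟨ cong (λ c → submatrixSum (suc m) + c + 2 ^ suc k) (columnSum-InBlock b′) ⟩
  submatrixSum (suc m) + (k + 2) + 2 ^ suc k          ≡⟨ xy∙z≈xz∙y (submatrixSum (suc m)) (k + 2) (2 ^ suc k) ⟩
  submatrixSum (suc m) + 2 ^ suc k + (k + 2)          ≡⟨ cong (_+ (k + 2)) (submatrixSum-InBlock b′) ⟩
  suc m * (k + 2) + (k + 2)                           ≡⟨ +-comm (suc m * (k + 2)) (k + 2) ⟩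
  suc (suc m) * (k + 2)                               ∎
... | boundary {k′} n≡2^[1+k′] b′ = begin
  submatrixSum (suc (suc m)) + 2 ^ suc (suc k′)       ≡⟨ cong (_+ 2 ^ suc (suc k′)) (submatrixSum-suc (suc m)) ⟩
  S + columnSum (suc m) + 2 * 2 ^ suc k′
    ≡⟨ cong₂ (λ c p → S + c + 2 * p) (columnSum-InBlock b′) (sym n≡2^[1+k′]) ⟩
  S + (k′ + 2) + 2 * suc (suc m)                      ≡⟨ regroup S k′ (suc (suc m)) ⟩
  S + suc (suc m) + (suc (suc m) + (k′ + 2))          ≡⟨ cong (λ p → S + p + (suc (suc m) + (k′ + 2))) n≡2^[1+k′] ⟩
  S + 2 ^ suc k′ + (suc (suc m) + (k′ + 2))           ≡⟨ cong (_+ (suc (suc m) + (k′ + 2))) (submatrixSum-InBlock b′) ⟩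
  suc m * (k′ + 2) + (suc (suc m) + (k′ + 2))         ≡⟨ collect m k′ ⟩
  suc (suc m) * (suc k′ + 2)                          ∎
  where
  S : ℕ
  S = submatrixSum (suc m)
  regroup : ∀ s k p → s + (k + 2) + 2 * p ≡ s + p + (p + (k + 2))
  regroup = solve-∀
  collect : ∀ m k → suc m * (k + 2) + (suc (suc m) + (k + 2)) ≡ suc (suc m) * (suc k + 2)
  collect = solve-∀

lemma6 : (n : ℕ) → 1 ≤ n → submatrixSum n ≡ s n
lemma6 (suc n) _ with blockOf n
... | k , b = begin
  submatrixSum (suc n)                                ≡⟨ m+n∸n≡m (submatrixSum (suc n)) (2 ^ suc k) ⟨
  submatrixSum (suc n) + 2 ^ suc k ∸ 2 ^ suc k        ≡⟨ cong (_∸ 2 ^ suc k) (submatrixSum-InBlock b) ⟩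
  suc n * (k + 2) ∸ 2 ^ suc k                         ≡⟨ cong (λ e → suc n * (k + 2) ∸ 2 ^ e) (+-comm 1 k) ⟩
  suc n * (k + 2) ∸ 2 ^ (k + 1)                       ≡⟨ cong (λ l → suc n * (l + 2) ∸ 2 ^ (l + 1)) (⌊log₂⌋-InBlock b) ⟨
  s (suc n)                                           ∎
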